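{- Let $x\in\mathcal S$ with $x\ne x^{\max}$, let $w\in W$, let $(c,a)$ be a legal $w$-pair under $x$, and put $z:=x_w+\mathbf 1^a-\mathbf 1^c$. Let $d\in (U_F^+(x)\cap E_w)\setminus\{a\}$ be interesting for $w$ under $z$. Then $(c,d)$ is a legal $w$-pair under $x$ and $x_w+\mathbf 1^d-\mathbf 1^c\succ_w z$.
   Context: Model. $G=(V,E)$ is a finite bipartite graph without multiple edges with color classes $W$ and $F$; an edge joining $w\in W$, $f\in F$ is written $wf$. Capacities $b\in\mathbb Z_+^E$. For $v\in V$, $E_v$ is the set of edges at $v$, $\mathcal B_v=\{z\in\mathbb Z_+^{E_v}:z\le b|_{E_v}\}$, $\mathcal B=\{x\in\mathbb Z_+^E:x\le b\}$, $x_v$ the restriction of $x$ to $E_v$. Vector inequalities componentwise, $\wedge,\vee$ componentwise min/max, $|z|=\sum_e|z(e)|$, $\mathbf 1^e$ unit vector of $e$. Each $v$ has a choice function $C_v:\mathcal B_v\to\mathcal B_v$, $C_v(z)\le z$, with: (A1) $z\ge z'\ge C_v(z)\Rightarrow C_v(z')=C_v(z)$; (A2) $z\ge z'\Rightarrow C_v(z)\wedge z'\le C_v(z')$; (A3) $z\ge z'\Rightarrow|C_v(z)|\ge|C_v(z')|$. $z$ is acceptable if $C_v(z)=z$; for distinct acceptable $z,z'$, $z'\prec_v z$ (i.e. $z\succ_v z'$) iff $C_v(z\vee z')=z$. $e\in E_v$ is interesting for $v$ under acceptable $z$ if some $z'\in\mathcal B_v$ agrees with $z$ off $e$, has $z'(e)>z(e)$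 and $C_v(z')(e)>z(e)$. A g-matching is $x\in\mathcal B$ with all $x_v$ acceptable; $wf$ blocks $x$ if interesting for $w$ under $x_w$ and for $f$ under $x_f$; stable = no blocking edge; $\mathcal S$ = stable g-matchings; $(\mathcal S,\prec_F)$, where $x\prec_F y$ for distinct $x,y$ iff $x_f\preceq_f y_f$ for all $f\in F$, is a finite distributive lattice with greatest element $x^{\max}$. For $x\in\mathcal S$: $U_F^+(x)$ is the set of edges $wf$ interesting for $f$ under $x_f$; $U_F^-(x)$ is the set of edges $wf$ with $x(wf)>0$ not interesting for $f$ under $x_f$. For $w\in W$, a legal $w$-pair under $x$ is a pair $(c,a)$ of edges of $E_w$ with $c\in U_F^-(x)$, $a\in U_F^+(x)$ such that $x_w+\mathbf 1^a-\mathbf 1^c$ is acceptable for $w$. -}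

module Defs where

open import Data.Nat using (ℕ; zero; suc; _+_; _∸_; _≤_; _<_; _⊔_; _⊓_)
open import Data.Fin using (Fin; zero; suc; _≟_)
open import Data.Sum using (_⊎_; inj₁; inj₂)
open import Data.Product using (Σ; _×_; _,_; ∃)
open import Relation.Nullary using (¬_; does)
open import Relation.Binary.PropositionalEquality using (_≡_)
open import Data.Bool using (if_then_else_)

∑ : ∀ {n} → (Fin n → ℕ) → ℕ
∑ {zero}  z = 0
∑ {suc n} z = z zero + ∑ (λ i → z (suc i))

-- A finite bipartite graph without multiple edges, with capacities.
-- Edges are Fin m; edge e joins wEnd e ∈ W = Fin nW and fEnd e ∈ F = Fin nF.
record Graph : Set where
  field
    nW nF m : ℕ
    wEnd    : Fin m → Fin nW
    fEnd    : Fin m → Fin nF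
    noMulti : ∀ e e′ → wEnd e ≡ wEnd e′ → fEnd e ≡ fEnd e′ → e ≡ e′
    b       : Fin m → ℕ

module GraphDefs (G : Graph) where
  open Graph G public

  V : Set
  V = Fin nW ⊎ Fin nF

  Vec : Set
  Vec = Fin m → ℕ

  inc? : V → Fin m → Data.Bool.Bool
  inc? (inj₁ w) e = does (wEnd e ≟ w)
  inc? (inj₂ f) e = does (fEnd e ≟ f)

  Inc : V → Fin m → Set
  Inc (inj₁ w) e = wEnd e ≡ w
  Inc (inj₂ f) e = fEnd e ≡ f

  _≤v_ : Vec → Vec → Set
  z ≤v z′ = ∀ e → z e ≤ z′ e

  _≗v_ : Vec → Vec → Set
  z ≗v z′ = ∀ e → z e ≡ z′ e

  _∧v_ : Vec → Vec → Vec
  (z ∧v z′) e = z e ⊓ z′ e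

  _∨v_ : Vec → Vec → Vec
  (z ∨v z′) e = z e ⊔ z′ e

  ∣_∣ : Vec → ℕ
  ∣ z ∣ = ∑ z

  𝟙 : Fin m → Vec
  𝟙 a e = if does (e ≟ a) then 1 else 0

  InB : Vec → Set
  InB x = x ≤v b

  -- B_v: vectors on E_v (identified with vectors on E vanishing off E_v) bounded by b
  InBv : V → Vec → Set
  InBv v z = (z ≤v b) × (∀ e → ¬ Inc v e → z e ≡ 0)

  restr : V → Vec → Vec
  restr v x e = if inc? v e then x e else 0

-- Choice functions C_v : B_v → B_v satisfying (A1)–(A3).
-- C v is only constrained on B_v.
record ChoiceModel : Set₁ where
  field
    G : Graph
  open GraphDefs G
  field
    C      : V → Vec → Vec
    C-≤    : ∀ v z → InBv v z → C v z ≤v z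
    C-Bv   : ∀ v z → InBv v z → InBv v (C v z)
    A1     : ∀ v z z′ → InBv v z → InBv v z′ → z′ ≤v z → C v z ≤v z′
               → C v z′ ≗v C v z
    A2     : ∀ v z z′ → InBv v z → InBv v z′ → z′ ≤v z → (C v z ∧v z′) ≤v C v z′
    A3     : ∀ v z z′ → InBv v z → InBv v z′ → z′ ≤v z → ∣ C v z′ ∣ ≤ ∣ C v z ∣

module Theory (M : ChoiceModel) where
  open ChoiceModel M public
  open GraphDefs G public

  Acceptable : V → Vec → Set
  Acceptable v z = InBv v z × (C v z ≗v z)

  _≺[_]_ : Vec → V → Vec → Set
  z′ ≺[ v ] z = Acceptable v z × Acceptable v z′ × ¬ (z ≗v z′) × (C v (z ∨v z′) ≗v z)

  Interesting : V → Fin m → Vec → Set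
  Interesting v e z = Inc v e × Σ Vec λ z′ → InBv v z′
    × (∀ e′ → ¬ (e′ ≡ e) → z′ e′ ≡ z e′)
    × (z e < z′ e) × (z e < C v z′ e)

  GMatching : Vec → Set
  GMatching x = InB x × (∀ v → Acceptable v (restr v x))

  Blocks : Vec → Fin m → Set
  Blocks x e = Interesting (inj₁ (wEnd e)) e (restr (inj₁ (wEnd e)) x)
             × Interesting (inj₂ (fEnd e)) e (restr (inj₂ (fEnd e)) x)

  Stable : Vec → Set
  Stable x = GMatching x × (∀ e → ¬ Blocks x e)

  _⪯F_ : Vec → Vec → Set
  x ⪯F y = (x ≗v y) ⊎ (∀ f → (restr (inj₂ f) x ≗v restr (inj₂ f) y)
                             ⊎ (restr (inj₂ f) x ≺[ inj₂ f ] restr (inj₂ f) y))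

  IsMaxStable : Vec → Set
  IsMaxStable xm = Stable xm × (∀ y → Stable y → y ⪯F xm)

  UFplus : Vec → Fin m → Set
  UFplus x e = Interesting (inj₂ (fEnd e)) e (restr (inj₂ (fEnd e)) x)

  UFminus : Vec → Fin m → Set
  UFminus x e = (0 < x e) × ¬ Interesting (inj₂ (fEnd e)) e (restr (inj₂ (fEnd e)) x)

  swap : Fin nW → Vec → Fin m → Fin m → Vec
  swap w x c a e = (restr (inj₁ w) x e + 𝟙 a e) ∸ 𝟙 c e

  LegalPair : Vec → Fin nW → Fin m → Fin m → Set
  LegalPair x w c a = Inc (inj₁ w) c × Inc (inj₁ w) a
    × UFminus x c × UFplus x a × Acceptable (inj₁ w) (swap w x c a)

-- Stability of x makes a and d uninteresting for w under x_w, so adding one unit at a, at d, or at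
-- both changes nothing in w's choice: C_w(x_w + 1^a + 1^d) = x_w. Put y = z + 1^d. By (A2),
-- comparing y with x_w + 1^a + 1^d shows that C_w(y) contains x_w − 1^c off d, and comparing y with
-- the vector witnessing that d is interesting under z shows C_w(y)(d) > z(d). Hence C_w(y) contains
-- z' = x_w + 1^d − 1^c, while (A3) bounds |C_w(y)| by |x_w| = |z'|. So C_w(y) = z', and (A1) turns
-- this into the acceptability of z' and C_w(z ∨ z') = z', as z ≤ z ∨ z' ≤ y.
module Submission where

open import Defs
open import Data.Bool using (if_then_else_)
open import Data.Fin using (Fin; zero; suc; _≟_)
open import Data.Nat using (ℕ; zero; suc; _+_; _∸_; _≤_; _<_; _⊓_; z≤n)
open import Data.Nat.Properties
  using ( ≤-refl; ≤-trans; ≤-antisym; ≤-reflexive; <⇒≱; ≮⇒≥; n≤0⇒n≡0; +-comm; +-identityʳ; +-mono-≤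
        ; +-monoˡ-≤; +-cancelˡ-≤; +-cancelʳ-≤; +-cancelʳ-≡; m≤m+n; m∸n≤m; ∸-monoˡ-≤
        ; m∸n+n≡m; ⊓-glb; ⊔-lub; m≤m⊔n; +-commutativeSemigroup )
open import Algebra.Properties.CommutativeSemigroup +-commutativeSemigroup using (interchange)
open import Data.Product using (_×_; _,_; proj₁; proj₂)
open import Data.Sum using (inj₁; inj₂)
open import Relation.Nullary using (¬_; does; yes; no)
open import Relation.Nullary.Decidable using (dec-true; dec-false)
open import Relation.Binary.PropositionalEquality
  using (_≡_; _≢_; refl; sym; trans; cong; cong₂; subst)

m⊓n≤o<n⇒m≤o : ∀ {m n o} → m ⊓ n ≤ o → o < n → m ≤ o
m⊓n≤o<n⇒m≤o m⊓n≤o o<n = ≮⇒≥ λ o<m → <⇒≱ (⊓-glb o<m o<n) m⊓n≤o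

+-mono-≤-tight : ∀ {a b c d} → a ≤ c → b ≤ d → c + d ≤ a + b → a ≡ c × b ≡ d
+-mono-≤-tight {a} {b} {c} {d} a≤c b≤d c+d≤a+b =
  ≤-antisym a≤c (+-cancelʳ-≤ d c a (≤-trans c+d≤a+b (+-mono-≤ ≤-refl b≤d))) ,
  ≤-antisym b≤d (+-cancelˡ-≤ c d b (≤-trans c+d≤a+b (+-mono-≤ a≤c ≤-refl)))

at-or-off : ∀ {n} {P : Fin n → Set} (a : Fin n) → P a → (∀ e → e ≢ a → P e) → ∀ e → P e
at-or-off a Pa Poff e with e ≟ a
... | yes refl = Pa
... | no e≢a = Poff e e≢a

δ : ∀ {n} → Fin n → Fin n → ℕ
δ a e = if does (e ≟ a) then 1 else 0

δ-diag : ∀ {n} (a : Fin n) → δ a a ≡ 1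
δ-diag a rewrite dec-true (a ≟ a) refl = refl

δ-off : ∀ {n} {a e : Fin n} → e ≢ a → δ a e ≡ 0
δ-off {a = a} {e} e≢a rewrite dec-false (e ≟ a) e≢a = refl

δ≤ : ∀ {n} {z : Fin n → ℕ} {c : Fin n} → 1 ≤ z c → ∀ e → δ c e ≤ z e
δ≤ {z = z} {c} 1≤zc = at-or-off c (subst (_≤ z c) (sym (δ-diag c)) 1≤zc)
                                   (λ e e≢c → subst (_≤ z e) (sym (δ-off e≢c)) z≤n)

infixl 25 _+𝟙_ _−𝟙_

_+𝟙_ : ∀ {n} → (Fin n → ℕ) → Fin n → Fin n → ℕ
(z +𝟙 a) e = z e + δ a e

_−𝟙_ : ∀ {n} → (Fin n → ℕ) → Fin n → Fin n → ℕ
(z −𝟙 c) e = z e ∸ δ c e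

module _ {n : ℕ} (z : Fin n → ℕ) where

  +𝟙-diag : ∀ a → (z +𝟙 a) a ≡ suc (z a)
  +𝟙-diag a = trans (cong (z a +_) (δ-diag a)) (+-comm (z a) 1)

  +𝟙-off : ∀ {a e} → e ≢ a → (z +𝟙 a) e ≡ z e
  +𝟙-off {e = e} e≢a = trans (cong (z e +_) (δ-off e≢a)) (+-identityʳ (z e))

  −𝟙-off : ∀ {c e} → e ≢ c → (z −𝟙 c) e ≡ z e
  −𝟙-off {e = e} e≢c = cong (z e ∸_) (δ-off e≢c)

  ≤-+𝟙 : ∀ a {e} → z e ≤ (z +𝟙 a) e
  ≤-+𝟙 a {e} = m≤m+n (z e) (δ a e)

  −𝟙-≤ : ∀ {c e} → (z −𝟙 c) e ≤ z e
  −𝟙-≤ {c} {e} = m∸n≤m (z e) (δ c e)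

∑-cong : ∀ {n} {f g : Fin n → ℕ} → (∀ i → f i ≡ g i) → ∑ f ≡ ∑ g
∑-cong {zero} f≗g = refl
∑-cong {suc n} f≗g = cong₂ _+_ (f≗g zero) (∑-cong (λ i → f≗g (suc i)))

∑-mono : ∀ {n} {f g : Fin n → ℕ} → (∀ i → f i ≤ g i) → ∑ f ≤ ∑ g
∑-mono {zero} f≤g = z≤n
∑-mono {suc n} f≤g = +-mono-≤ (f≤g zero) (∑-mono (λ i → f≤g (suc i)))

∑-mono-tight : ∀ {n} {f g : Fin n → ℕ} → (∀ i → f i ≤ g i) → ∑ g ≤ ∑ f → ∀ i → f i ≡ g i
∑-mono-tight {suc n} {f} {g} f≤g ∑g≤∑f = λ where
    zero → proj₁ heads-and-tails
    (suc i) → ∑-mono-tight (λ i → f≤g (suc i)) (≤-reflexive (sym (proj₂ heads-and-tails))) i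
  where
  heads-and-tails : f zero ≡ g zero × ∑ (λ i → f (suc i)) ≡ ∑ (λ i → g (suc i))
  heads-and-tails = +-mono-≤-tight (f≤g zero) (∑-mono (λ i → f≤g (suc i))) ∑g≤∑f

∑-distrib-+ : ∀ {n} (f g : Fin n → ℕ) → ∑ (λ i → f i + g i) ≡ ∑ f + ∑ g
∑-distrib-+ {zero} f g = refl
∑-distrib-+ {suc n} f g =
  trans (cong (f zero + g zero +_) (∑-distrib-+ (λ i → f (suc i)) (λ i → g (suc i))))
        (interchange (f zero) (g zero) _ _)

∑-zero : ∀ n → ∑ {n} (λ _ → 0) ≡ 0
∑-zero zero = refl
∑-zero (suc n) = ∑-zero n

∑-δ : ∀ {n} (c : Fin n) → ∑ (δ c) ≡ 1
∑-δ {suc n} zero = cong suc (∑-zero n)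
∑-δ (suc c) = ∑-δ c

∑-+𝟙 : ∀ {n} (z : Fin n → ℕ) (a : Fin n) → ∑ (z +𝟙 a) ≡ ∑ z + 1
∑-+𝟙 z a = trans (∑-distrib-+ z (δ a)) (cong (∑ z +_) (∑-δ a))

∑-−𝟙 : ∀ {n} {z : Fin n → ℕ} {c : Fin n} → 1 ≤ z c → ∑ (z −𝟙 c) + 1 ≡ ∑ z
∑-−𝟙 {z = z} {c} 1≤zc = begin
  ∑ (z −𝟙 c) + 1                      ≡⟨ cong (∑ (z −𝟙 c) +_) (sym (∑-δ c)) ⟩
  ∑ (z −𝟙 c) + ∑ (δ c)                ≡⟨ sym (∑-distrib-+ (z −𝟙 c) (δ c)) ⟩
  ∑ (λ e → (z e ∸ δ c e) + δ c e)     ≡⟨ ∑-cong (λ e → m∸n+n≡m (δ≤ {z = z} {c} 1≤zc e)) ⟩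
  ∑ z                                 ∎
  where open Relation.Binary.PropositionalEquality.≡-Reasoning

∑-+𝟙−𝟙 : ∀ {n} {z : Fin n → ℕ} {c : Fin n} (d : Fin n) → 1 ≤ z c → ∑ (z +𝟙 d −𝟙 c) ≡ ∑ z
∑-+𝟙−𝟙 {z = z} d 1≤zc =
  +-cancelʳ-≡ 1 _ _ (trans (∑-−𝟙 {z = z +𝟙 d} (≤-trans 1≤zc (≤-+𝟙 z d))) (∑-+𝟙 z d))

module ChoiceProperties (M : ChoiceModel) where
  open Theory M

  InBv-downward : ∀ {v y y′} → y ≤v y′ → InBv v y′ → InBv v y
  InBv-downward y≤y′ (y′≤b , y′-off) =
    (λ e → ≤-trans (y≤y′ e) (y′≤b e)) ,
    (λ e e∉v → n≤0⇒n≡0 (subst (_ ≤_) (y′-off e e∉v) (y≤y′ e)))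

  InBv-+𝟙 : ∀ {v s e} → InBv v s → Inc v e → suc (s e) ≤ b e → InBv v (s +𝟙 e)
  InBv-+𝟙 {v} {s} {e} (s≤b , s-off) e∈v suc-se≤be = bounded , vanishes
    where
    bounded : s +𝟙 e ≤v b
    bounded = at-or-off e (subst (_≤ b e) (sym (+𝟙-diag s e)) suc-se≤be)
                          (λ e′ e′≢e → subst (_≤ b e′) (sym (+𝟙-off s e′≢e)) (s≤b e′))
    vanishes : ∀ e′ → ¬ Inc v e′ → (s +𝟙 e) e′ ≡ 0
    vanishes e′ e′∉v = trans (+𝟙-off s λ { refl → e′∉v e∈v }) (s-off e′ e′∉v)

  C-+𝟙-of-¬Interesting : ∀ {v s e} → Acceptable v s → Inc v e → InBv v (s +𝟙 e) →
    ¬ Interesting v e s → C v (s +𝟙 e) ≗v s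
  C-+𝟙-of-¬Interesting {v} {s} {e} (s∈B , Cs≗s) e∈v s+e∈B ¬int e′ =
    trans (sym (A1 v (s +𝟙 e) s s+e∈B s∈B (λ _ → ≤-+𝟙 s e) C≤s e′)) (Cs≗s e′)
    where
    C≤s : C v (s +𝟙 e) ≤v s
    C≤s = at-or-off e
      (≮⇒≥ λ s<C → ¬int (e∈v , s +𝟙 e , s+e∈B , (λ _ → +𝟙-off s) ,
                         ≤-reflexive (sym (+𝟙-diag s e)) , s<C))
      (λ e′ e′≢e → subst (C v (s +𝟙 e) e′ ≤_) (+𝟙-off s e′≢e) (C-≤ v (s +𝟙 e) s+e∈B e′))

  C-+𝟙+𝟙-of-¬Interesting : ∀ {v s a d} → Acceptable v s → Inc v a → Inc v d →
    InBv v (s +𝟙 a +𝟙 d) → ¬ Interesting v a s → ¬ Interesting v d s → C v (s +𝟙 a +𝟙 d) ≗v s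
  C-+𝟙+𝟙-of-¬Interesting {v} {s} {a} {d} s-acc a∈v d∈v u∈B ¬int-a ¬int-d e =
    trans (sym (A1 v u (s +𝟙 a) u∈B s+a∈B s+a≤u Cu≤s+a e))
          (C-+𝟙-of-¬Interesting s-acc a∈v s+a∈B ¬int-a e)
    where
    u : Vec
    u = s +𝟙 a +𝟙 d
    s+a≤u : s +𝟙 a ≤v u
    s+a≤u _ = ≤-+𝟙 (s +𝟙 a) d
    s+d≤u : s +𝟙 d ≤v u
    s+d≤u e = +-monoˡ-≤ (δ d e) (≤-+𝟙 s a)
    s+a∈B : InBv v (s +𝟙 a)
    s+a∈B = InBv-downward s+a≤u u∈B
    s+d∈B : InBv v (s +𝟙 d)
    s+d∈B = InBv-downward s+d≤u u∈B
    Cud≤sd : C v u d ≤ s d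
    Cud≤sd = m⊓n≤o<n⇒m≤o
      (subst (C v u d ⊓ (s +𝟙 d) d ≤_) (C-+𝟙-of-¬Interesting s-acc d∈v s+d∈B ¬int-d d)
             (A2 v u (s +𝟙 d) u∈B s+d∈B s+d≤u d))
      (≤-reflexive (sym (+𝟙-diag s d)))
    Cu≤s+a : C v u ≤v s +𝟙 a
    Cu≤s+a = at-or-off d (≤-trans Cud≤sd (≤-+𝟙 s a))
      (λ e e≢d → subst (C v u e ≤_) (+𝟙-off (s +𝟙 a) e≢d) (C-≤ v u u∈B e))

  Acceptable-of-C≗ : ∀ {v y t} → InBv v y → C v y ≗v t → Acceptable v t
  Acceptable-of-C≗ {v} {y} {t} y∈B Cy≗t = t∈B , λ e → trans (A1 v y t y∈B t∈B t≤y Cy≤t e) (Cy≗t e)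
    where
    t≤y : t ≤v y
    t≤y e = subst (_≤ y e) (Cy≗t e) (C-≤ v y y∈B e)
    Cy≤t : C v y ≤v t
    Cy≤t e = ≤-reflexive (Cy≗t e)
    t∈B : InBv v t
    t∈B = InBv-downward t≤y y∈B

  ≺-of-C≗ : ∀ {v y z t} → InBv v y → C v y ≗v t → Acceptable v z → z ≤v y → ¬ (t ≗v z) →
    z ≺[ v ] t
  ≺-of-C≗ {v} {y} {z} {t} y∈B Cy≗t z-acc z≤y t≉z = t-acc , z-acc , t≉z , λ e →
    trans (A1 v y (t ∨v z) y∈B t∨z∈B t∨z≤y Cy≤t∨z e) (Cy≗t e)
    where
    t-acc : Acceptable v t
    t-acc = Acceptable-of-C≗ y∈B Cy≗t
    t∨z≤y : (t ∨v z) ≤v y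
    t∨z≤y e = ⊔-lub (subst (_≤ y e) (Cy≗t e) (C-≤ v y y∈B e)) (z≤y e)
    Cy≤t∨z : C v y ≤v (t ∨v z)
    Cy≤t∨z e = subst (_≤ (t ∨v z) e) (sym (Cy≗t e)) (m≤m⊔n (t e) (z e))
    t∨z∈B : InBv v (t ∨v z)
    t∨z∈B = InBv-downward t∨z≤y y∈B

  exchange-≺ : ∀ {v s a c d} → Acceptable v s → Inc v a → Inc v d →
    ¬ Interesting v a s → ¬ Interesting v d s → a ≢ c → d ≢ a → d ≢ c → 1 ≤ s c →
    Acceptable v (s +𝟙 a −𝟙 c) → Interesting v d (s +𝟙 a −𝟙 c) →
    s +𝟙 a −𝟙 c ≺[ v ] s +𝟙 d −𝟙 c
  exchange-≺ {v} {s} {a} {c} {d} s-acc a∈v d∈v ¬int-a ¬int-d a≢c d≢a d≢c 1≤sc z-acc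
             (_ , z″ , z″∈B , z″≈z , zd<z″d , zd<Cz″d) =
    ≺-of-C≗ y∈B (λ e → sym (∑-mono-tight z′≤Cy ∑Cy≤∑z′ e)) z-acc (λ e → ≤-+𝟙 z d {e}) z′≉z
    where
    z z′ y u : Vec
    z = s +𝟙 a −𝟙 c
    z′ = s +𝟙 d −𝟙 c
    y = z +𝟙 d
    u = s +𝟙 a +𝟙 d
    zd≡sd : z d ≡ s d
    zd≡sd = trans (−𝟙-off (s +𝟙 a) d≢c) (+𝟙-off s d≢a)
    za≡1+sa : z a ≡ suc (s a)
    za≡1+sa = trans (−𝟙-off (s +𝟙 a) a≢c) (+𝟙-diag s a)
    u∈B : InBv v u
    u∈B = InBv-+𝟙 (InBv-+𝟙 (proj₁ s-acc) a∈v (subst (_≤ b a) za≡1+sa (proj₁ (proj₁ z-acc) a)))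
            d∈v (subst (λ k → suc k ≤ b d) (−𝟙-off (s +𝟙 a) d≢c) (≤-trans zd<z″d (proj₁ z″∈B d)))
    Cu≗s : C v u ≗v s
    Cu≗s = C-+𝟙+𝟙-of-¬Interesting s-acc a∈v d∈v u∈B ¬int-a ¬int-d
    y≤u : y ≤v u
    y≤u e = +-monoˡ-≤ (δ d e) (−𝟙-≤ (s +𝟙 a))
    y∈B : InBv v y
    y∈B = InBv-downward y≤u u∈B
    y≤z″ : y ≤v z″
    y≤z″ = at-or-off d (≤-trans (≤-reflexive (+𝟙-diag z d)) zd<z″d)
      (λ e e≢d → ≤-reflexive (trans (+𝟙-off z e≢d) (sym (z″≈z e e≢d))))
    z′d≡1+zd : z′ d ≡ suc (z d)
    z′d≡1+zd = trans (trans (−𝟙-off (s +𝟙 d) d≢c) (+𝟙-diag s d)) (cong suc (sym zd≡sd))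
    z′≤Cy : z′ ≤v C v y
    z′≤Cy = at-or-off d
      (≤-trans (≤-reflexive z′d≡1+zd)
        (≤-trans (⊓-glb zd<Cz″d (≤-reflexive (sym (+𝟙-diag z d)))) (A2 v z″ y z″∈B y∈B y≤z″ d)))
      (λ e e≢d → ≤-trans (⊓-glb (z′e≤Cue e≢d) (z′e≤ye e≢d)) (A2 v u y u∈B y∈B y≤u e))
      where
      z′e≤Cue : ∀ {e} → e ≢ d → z′ e ≤ C v u e
      z′e≤Cue {e} e≢d =
        ≤-trans (−𝟙-≤ (s +𝟙 d)) (≤-reflexive (trans (+𝟙-off s e≢d) (sym (Cu≗s e))))
      z′e≤ye : ∀ {e} → e ≢ d → z′ e ≤ y e
      z′e≤ye {e} e≢d =
        ≤-trans (∸-monoˡ-≤ (δ c e) (≤-trans (≤-reflexive (+𝟙-off s e≢d)) (≤-+𝟙 s a))) (≤-+𝟙 z d {e})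
    z′≉z : ¬ (z′ ≗v z)
    z′≉z z′≗z = <⇒≱ (≤-reflexive (sym z′d≡1+zd)) (≤-reflexive (z′≗z d))
    ∑Cy≤∑z′ : ∑ (C v y) ≤ ∑ z′
    ∑Cy≤∑z′ = ≤-trans (A3 v u y u∈B y∈B y≤u)
                      (≤-reflexive (trans (∑-cong Cu≗s) (sym (∑-+𝟙−𝟙 d 1≤sc))))

  Stable⇒¬Interesting : ∀ {x w e} → Stable x → Inc (inj₁ w) e → UFplus x e →
    ¬ Interesting (inj₁ w) e (restr (inj₁ w) x)
  Stable⇒¬Interesting (_ , ¬blocks) refl e∈U⁺ int = ¬blocks _ (int , e∈U⁺)

  UFplus-≢-UFminus : ∀ {x c e} → UFminus x c → UFplus x e → e ≢ c
  UFplus-≢-UFminus (_ , ¬c∈U⁺) e∈U⁺ refl = ¬c∈U⁺ e∈U⁺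

  restr-Inc : ∀ {v x e} → Inc v e → restr v x e ≡ x e
  restr-Inc {inj₁ w} {x} {e} e∈v rewrite dec-true (wEnd e ≟ w) e∈v = refl
  restr-Inc {inj₂ f} {x} {e} e∈v rewrite dec-true (fEnd e ≟ f) e∈v = refl

lemma3p3 : (M : ChoiceModel) → let open Theory M in
    (x xmax : Vec) → IsMaxStable xmax → Stable x → ¬ (x ≗v xmax) →
    (w : Fin nW) (c a : Fin m) → LegalPair x w c a →
    (d : Fin m) → UFplus x d → Inc (inj₁ w) d → ¬ (d ≡ a) →
    Interesting (inj₁ w) d (swap w x c a) →
    LegalPair x w c d × (swap w x c a ≺[ inj₁ w ] swap w x c d)
lemma3p3 M x _ _ x-stable _ w c a (c∈w , a∈w , c∈U⁻ , a∈U⁺ , z-acc) d d∈U⁺ d∈w d≢a int-d =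
  (c∈w , d∈w , c∈U⁻ , d∈U⁺ , proj₁ z≺z′) , z≺z′
  where
  open Theory M
  open ChoiceProperties M
  z≺z′ : swap w x c a ≺[ inj₁ w ] swap w x c d
  z≺z′ = exchange-≺ (proj₂ (proj₁ x-stable) (inj₁ w)) a∈w d∈w
    (Stable⇒¬Interesting x-stable a∈w a∈U⁺) (Stable⇒¬Interesting x-stable d∈w d∈U⁺)
    (UFplus-≢-UFminus c∈U⁻ a∈U⁺) d≢a (UFplus-≢-UFminus c∈U⁻ d∈U⁺)
    (subst (1 ≤_) (sym (restr-Inc {inj₁ w} {x} c∈w)) (proj₁ c∈U⁻)) z-acc int-d
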